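{- Let $c$ be a Coxeter element of $A_n$. For each upper-barred integer $u$ and each integer $1\le k\le\mu(u)$, where $\mu(u)=\min(u-1,n+1-u)$, the position $(n+2-k,\,c^k(u))$ lies strictly below the main diagonal, i.e., $c^k(u)<n+2-k$.
   Context: $A_n$ is the symmetric group on $[n+1]$. A Coxeter element is $c=s_{a_1}\cdots s_{a_n}$ with $(a_1,\dots,a_n)$ a permutation of $[n]$, where $s_i$ exchanges $i,i+1$. For $i\in\{2,\dots,n\}$, $i$ is lower-barred if $i-1$ precedes $i$ in $(a_1,\dots,a_n)$, upper-barred otherwise; $d_1<\dots<d_r$ are the lower-barred and $u_1<\dots<u_s$ the upper-barred numbers. As a permutation (composing as functions), $c$ is the $(n+1)$-cycle $1\mapsto d_1\mapsto\cdots\mapsto d_r\mapsto n+1\mapsto u_s\mapsto\cdots\mapsto u_1\mapsto1$, and $c^k$ denotes its $k$-th power. -}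

module Defs where

open import Data.Nat using (ℕ; zero; suc; _≤_; _∸_; _⊔_; _⊓_; _≡ᵇ_)
open import Data.Bool using (if_then_else_)
open import Data.List using (List; []; _∷_; _++_; map; upTo; foldr)
open import Data.List.Membership.Propositional using (_∈_)
open import Data.List.Relation.Binary.Permutation.Propositional using (_↭_)
open import Data.Product using (∃₂; _×_)
open import Relation.Binary.PropositionalEquality using (_≡_)
open import Relation.Nullary using (¬_)
open import Function using (_∘_; id)

oneTo : ℕ → List ℕ
oneTo n = map suc (upTo n)

IsCoxeterWord : ℕ → List ℕ → Set
IsCoxeterWord n a = a ↭ oneTo n

s : ℕ → ℕ → ℕ
s i x = if x ≡ᵇ i then suc i else (if x ≡ᵇ suc i then i else x)

-- c = s_{a₁} ⋯ s_{aₙ}, composing as functions: c x = s_{a₁} (s_{a₂} ( ⋯ (s_{aₙ} x))).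
coxeter : List ℕ → ℕ → ℕ
coxeter a = foldr (λ i f → s i ∘ f) id a

iter : ℕ → (ℕ → ℕ) → ℕ → ℕ
iter zero    f = id
iter (suc k) f = f ∘ iter k f

Precedes : List ℕ → ℕ → ℕ → Set
Precedes a x y = ∃₂ λ l₁ l₂ → (a ≡ l₁ ++ l₂) × (x ∈ l₁) × (y ∈ l₂)

UpperBarred : ℕ → List ℕ → ℕ → Set
UpperBarred n a i = (2 ≤ i) × (i ≤ n) × ¬ Precedes a (i ∸ 1) i

μ : ℕ → ℕ → ℕ
μ n u = (u ∸ 1) ⊓ (suc n ∸ u)

{-# OPTIONS --safe #-}
-- Since s_i and s_j commute for |i - j| ≥ 2, c only depends on which of i - 1 and i comes
-- first in the word, and peeling off s_n inductively shows that c is the cycle 1 → d₁ → ⋯ → n+1 → u_s → ⋯ → u₁ → 1: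
-- it sends 1 and each lower-barred number to the next lower-barred number (or n+1) above it,
-- and n+1 and each upper-barred number to the next upper-barred number (or 1) below it.
-- From an upper-barred u the orbit first runs down through the upper-barred numbers, so
-- c^k(u) ≤ u - k; after passing 1 it climbs through lower-barred numbers x < u, and counting
-- the visited points gives x + #{upper-barred in (x, u)} = k, so x ≤ k. Either way
-- c^k(u) + k ≤ n as long as k < u and k + u ≤ n + 1, which is what k ≤ μ(u) provides.
module Submission where

open import Defs
open import Data.Nat using (ℕ; _≤_; _<_; _+_; _∸_)
open import Data.List using (List)

open import Data.Bool using (Bool; true; false; if_then_else_; T)
open import Data.List using ([]; _∷_; _++_; [_]; map; upTo)
open import Data.List.Membership.DecPropositional Data.Nat._≟_ using (_∈?_)
open import Data.List.Membership.Propositional using (_∈_; _∉_)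
open import Data.List.Membership.Propositional.Properties
  using (∈-++⁻; ∈-++⁺ˡ; ∈-++⁺ʳ; ∈-∃++; ∈-map⁺; ∈-map⁻; ∈-upTo⁺; ∈-upTo⁻)
open import Data.List.Properties using (map-++; upTo-∷ʳ; ++-identityʳ)
open import Data.List.Relation.Binary.Permutation.Propositional using (_↭_; ↭-sym; ↭⇒↭ₛ)
open import Data.List.Relation.Binary.Permutation.Propositional.Properties
  using (drop-mid; ∈-resp-↭; ↭-empty-inv)
import Data.List.Relation.Unary.All as All
open import Data.List.Relation.Unary.All.Properties using (++⁻ʳ)
open import Data.List.Relation.Unary.AllPairs using (_∷_)
open import Data.List.Relation.Unary.Any using (here; there)
open import Data.List.Relation.Unary.Unique.Propositional using (Unique)
open import Data.List.Relation.Unary.Unique.Propositional.Properties using (upTo⁺)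
import Data.List.Relation.Unary.Unique.Propositional.Properties as Unique
open import Data.Nat using (zero; suc; z≤n; s≤s; z<s; _≟_; _≡ᵇ_)
open import Data.Nat.Properties
open import Data.Nat.Solver using (module +-*-Solver)
open import Data.Product using (∃; _×_; _,_; proj₁; proj₂)
open import Data.Sum using (_⊎_; inj₁; inj₂; [_,_]′; map₂)
open import Function using (_∘_; id)
open import Relation.Binary.PropositionalEquality hiding ([_])
open import Data.List.Relation.Binary.Permutation.Setoid.Properties (setoid ℕ) using (Unique-resp-↭)
open import Relation.Nullary using (yes; no; does; contradiction)

private
  variable
    β : ℕ → Bool
    n x v : ℕ

≡ᵇ-refl : ∀ i → (i ≡ᵇ i) ≡ true
≡ᵇ-refl zero    = refl
≡ᵇ-refl (suc i) = ≡ᵇ-refl i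

≢⇒≡ᵇ≡false : ∀ {i j} → i ≢ j → (i ≡ᵇ j) ≡ false
≢⇒≡ᵇ≡false {i} {j} i≢j with i ≡ᵇ j in eq
... | false = refl
... | true  = contradiction (≡ᵇ⇒≡ i j (subst T (sym eq) _)) i≢j

s-at : ∀ i → s i i ≡ suc i
s-at i rewrite ≡ᵇ-refl i = refl

s-at-suc : ∀ i → s i (suc i) ≡ i
s-at-suc i rewrite ≢⇒≡ᵇ≡false (1+n≢n {i}) | ≡ᵇ-refl i = refl

s-fix : ∀ {i x} → x ≢ i → x ≢ suc i → s i x ≡ x
s-fix x≢i x≢1+i rewrite ≢⇒≡ᵇ≡false x≢i | ≢⇒≡ᵇ≡false x≢1+i = refl

s-below : ∀ {i x} → x < i → s i x ≡ x
s-below x<i = s-fix (<⇒≢ x<i) (<⇒≢ (m<n⇒m<1+n x<i))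

s-above : ∀ {i x} → suc i < x → s i x ≡ x
s-above 1+i<x = s-fix (>⇒≢ (<-trans (n<1+n _) 1+i<x)) (>⇒≢ 1+i<x)

s-comm : ∀ {i j} x → suc i < j → s i (s j x) ≡ s j (s i x)
s-comm {i} {j} x 1+i<j with x ≟ i
... | yes refl rewrite s-below {j} (<-trans (n<1+n x) 1+i<j) | s-at x | s-below 1+i<j = refl
... | no x≢i with x ≟ suc i
... | yes refl rewrite s-below 1+i<j | s-at-suc i | s-below {j} (<-trans (n<1+n i) 1+i<j) = refl
... | no x≢1+i with x ≟ j
... | yes refl rewrite s-at x | s-above {i} (<-trans 1+i<j (n<1+n x)) | s-above 1+i<j | s-at x = refl
... | no x≢j with x ≟ suc j
... | yes refl rewrite s-at-suc j | s-above 1+i<j | s-above {i} (m<n⇒m<1+n 1+i<j) | s-at-suc j = refl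
... | no x≢1+j rewrite s-fix x≢j x≢1+j | s-fix x≢i x≢1+i | s-fix x≢j x≢1+j = refl

coxeter-++ : ∀ l₁ l₂ → coxeter (l₁ ++ l₂) ≗ coxeter l₁ ∘ coxeter l₂
coxeter-++ []       l₂ x = refl
coxeter-++ (i ∷ l₁) l₂ x = cong (s i) (coxeter-++ l₁ l₂ x)

coxeter-comm : ∀ l {j} → (∀ {i} → i ∈ l → suc i < j) → coxeter l ∘ s j ≗ s j ∘ coxeter l
coxeter-comm []      far x = refl
coxeter-comm (i ∷ l) far x = begin
  s i (coxeter l (s _ x)) ≡⟨ cong (s i) (coxeter-comm l (far ∘ there) x) ⟩
  s i (s _ (coxeter l x)) ≡⟨ s-comm (coxeter l x) (far (here refl)) ⟩
  s _ (s i (coxeter l x)) ∎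
  where open ≡-Reasoning

coxeter-insert-right : ∀ l₁ {l₂ j} → (∀ {i} → i ∈ l₂ → suc i < j) →
                       coxeter (l₁ ++ j ∷ l₂) ≗ coxeter (l₁ ++ l₂) ∘ s j
coxeter-insert-right l₁ {l₂} {j} far x = begin
  coxeter (l₁ ++ j ∷ l₂) x        ≡⟨ coxeter-++ l₁ (j ∷ l₂) x ⟩
  coxeter l₁ (s j (coxeter l₂ x)) ≡⟨ cong (coxeter l₁) (coxeter-comm l₂ far x) ⟨
  coxeter l₁ (coxeter l₂ (s j x)) ≡⟨ coxeter-++ l₁ l₂ (s j x) ⟨
  coxeter (l₁ ++ l₂) (s j x)      ∎
  where open ≡-Reasoning

coxeter-insert-left : ∀ l₁ {l₂ j} → (∀ {i} → i ∈ l₁ → suc i < j) →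
                      coxeter (l₁ ++ j ∷ l₂) ≗ s j ∘ coxeter (l₁ ++ l₂)
coxeter-insert-left l₁ {l₂} {j} far x = begin
  coxeter (l₁ ++ j ∷ l₂) x        ≡⟨ coxeter-++ l₁ (j ∷ l₂) x ⟩
  coxeter l₁ (s j (coxeter l₂ x)) ≡⟨ coxeter-comm l₁ far (coxeter l₂ x) ⟩
  s j (coxeter l₁ (coxeter l₂ x)) ≡⟨ cong (s j) (coxeter-++ l₁ l₂ x) ⟨
  s j (coxeter (l₁ ++ l₂) x)      ∎
  where open ≡-Reasoning

-- β i ≡ true encodes that i is lower-barred: then s_i commutes to the right end of the
-- word, otherwise to the left end.
cox : (ℕ → Bool) → ℕ → ℕ → ℕ
cox β zero    = id
cox β (suc n) = if β (suc n) then cox β n ∘ s (suc n) else s (suc n) ∘ cox β n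

cox-lower : β (suc n) ≡ true → cox β (suc n) x ≡ cox β n (s (suc n) x)
cox-lower eq rewrite eq = refl

cox-upper : β (suc n) ≡ false → cox β (suc n) x ≡ s (suc n) (cox β n x)
cox-upper eq rewrite eq = refl

cox-cong : ∀ {β β′} n → (∀ {i} → i ≤ n → β i ≡ β′ i) → cox β n ≗ cox β′ n
cox-cong {β′ = β′} (suc n) agree x rewrite agree (≤-refl {suc n}) with β′ (suc n)
... | true  = cox-cong n (agree ∘ m≤n⇒m≤1+n) (s (suc n) x)
... | false = cong (s (suc n)) (cox-cong n (agree ∘ m≤n⇒m≤1+n) x)
cox-cong zero agree x = refl

data Before {A : Set} : List A → A → A → Set where
  now   : ∀ {p q l} → q ∈ l → Before (p ∷ l) p q
  later : ∀ {x p q l} → Before l p q → Before (x ∷ l) p q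

Before⇒Precedes : ∀ {a p q} → Before a p q → Precedes a p q
Before⇒Precedes (now {p} {l = l} q∈l) = [ p ] , l , refl , here refl , q∈l
Before⇒Precedes (later {x} b) with l₁ , l₂ , refl , p∈l₁ , q∈l₂ ← Before⇒Precedes b =
  x ∷ l₁ , l₂ , refl , there p∈l₁ , q∈l₂

∈-++-insert : ∀ {A : Set} (l₁ : List A) {l₂ y q} → q ∈ l₁ ++ l₂ → q ∈ l₁ ++ y ∷ l₂
∈-++-insert l₁ q∈ with ∈-++⁻ l₁ q∈
... | inj₁ q∈l₁ = ∈-++⁺ˡ q∈l₁
... | inj₂ q∈l₂ = ∈-++⁺ʳ l₁ (there q∈l₂)

Before-insert : ∀ {A : Set} (l₁ : List A) {l₂ y p q} → Before (l₁ ++ l₂) p q → Before (l₁ ++ y ∷ l₂) p q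
Before-insert []       b           = later b
Before-insert (_ ∷ l₁) (now q∈)   = now (∈-++-insert l₁ q∈)
Before-insert (_ ∷ l₁) (later b)  = later (Before-insert l₁ b)

Before-++ : ∀ {A : Set} (l₁ : List A) {l₂ p q} → p ∈ l₁ → q ∈ l₂ → Before (l₁ ++ l₂) p q
Before-++ (_ ∷ l₁) (here refl) q∈l₂ = now (∈-++⁺ʳ l₁ q∈l₂)
Before-++ (_ ∷ l₁) (there p∈l₁) q∈l₂ = later (Before-++ l₁ p∈l₁ q∈l₂)

unique-++-disjoint : ∀ {A : Set} (xs : List A) {ys x} → Unique (xs ++ ys) → x ∈ xs → x ∉ ys
unique-++-disjoint (_ ∷ xs) (x∉ ∷ _)  (here refl)  x∈ys = All.lookup (++⁻ʳ xs x∉) x∈ys refl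
unique-++-disjoint (_ ∷ xs) (_ ∷ uniq) (there x∈xs) = unique-++-disjoint xs uniq x∈xs

oneTo-suc : ∀ n → oneTo (suc n) ≡ oneTo n ++ [ suc n ]
oneTo-suc n = trans (cong (map suc) (sym (upTo-∷ʳ n))) (map-++ suc (upTo n) [ n ])

∈-oneTo⁻ : ∀ {z} → z ∈ oneTo n → z ≤ n
∈-oneTo⁻ z∈ with i , i∈ , refl ← ∈-map⁻ suc z∈ = ∈-upTo⁻ i∈

top∈oneTo : ∀ n → suc n ∈ oneTo (suc n)
top∈oneTo n = ∈-map⁺ suc (∈-upTo⁺ (n<1+n n))

↭-oneTo-unique : ∀ {a} → a ↭ oneTo n → Unique a
↭-oneTo-unique a↭ = Unique-resp-↭ (↭⇒↭ₛ (↭-sym a↭)) (Unique.map⁺ suc-injective (upTo⁺ _))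

↭-oneTo-drop-top : ∀ l₁ {l₂} → l₁ ++ suc n ∷ l₂ ↭ oneTo (suc n) → l₁ ++ l₂ ↭ oneTo n
↭-oneTo-drop-top {n} l₁ {l₂} a↭ = subst (l₁ ++ l₂ ↭_) (++-identityʳ (oneTo n))
  (drop-mid l₁ (oneTo n) (subst (l₁ ++ suc n ∷ l₂ ↭_) (oneTo-suc n) a↭))

record Barring (n : ℕ) (a : List ℕ) : Set where
  field
    lowerBarred  : ℕ → Bool
    coxeter≗cox  : coxeter a ≗ cox lowerBarred n
    lower⇒before : ∀ i → lowerBarred i ≡ true → Before a (i ∸ 1) i

wordBarring : ∀ n a → a ↭ oneTo n → Barring n a
wordBarring zero a a↭[] with refl ← ↭-empty-inv a↭[] =
  record { lowerBarred = λ _ → false ; coxeter≗cox = λ _ → refl ; lower⇒before = λ _ () }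
wordBarring (suc n) a a↭ with l₁ , l₂ , refl ← ∈-∃++ (∈-resp-↭ (↭-sym a↭) (top∈oneTo n)) =
  record { lowerBarred = β′ ; coxeter≗cox = coxeter≗cox′ ; lower⇒before = lower⇒before′ }
  where
  rest↭ : l₁ ++ l₂ ↭ oneTo n
  rest↭ = ↭-oneTo-drop-top l₁ a↭

  open Barring (wordBarring n (l₁ ++ l₂) rest↭)
    renaming (lowerBarred to β₀; coxeter≗cox to coxeter≗cox₀; lower⇒before to lower⇒before₀)

  β′ : ℕ → Bool
  β′ i with i ≟ suc n
  ... | yes _ = does (n ∈? l₁)
  ... | no _  = β₀ i

  β-top : β′ (suc n) ≡ does (n ∈? l₁)
  β-top with suc n ≟ suc n
  ... | yes _     = refl
  ... | no 1+n≢1+n = contradiction refl 1+n≢1+n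

  β-other : ∀ {i} → i ≢ suc n → β′ i ≡ β₀ i
  β-other {i} i≢1+n with i ≟ suc n
  ... | yes i≡1+n = contradiction i≡1+n i≢1+n
  ... | no _      = refl

  agree : ∀ {i} → i ≤ n → β′ i ≡ β₀ i
  agree i≤n = β-other (<⇒≢ (s≤s i≤n))

  below-top : ∀ {z} → z ∈ l₁ ++ l₂ → z ≢ n → suc z < suc n
  below-top z∈ z≢n = s≤s (≤∧≢⇒< (∈-oneTo⁻ (∈-resp-↭ rest↭ z∈)) z≢n)

  rest≗ : coxeter (l₁ ++ l₂) ≗ cox β′ n
  rest≗ x = trans (coxeter≗cox₀ x) (sym (cox-cong n agree x))

  coxeter≗cox′ : coxeter (l₁ ++ suc n ∷ l₂) ≗ cox β′ (suc n)
  coxeter≗cox′ x with n ∈? l₁ | β-top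
  ... | yes n∈l₁ | βN = begin
    coxeter (l₁ ++ suc n ∷ l₂) x     ≡⟨ coxeter-insert-right l₁ far x ⟩
    coxeter (l₁ ++ l₂) (s (suc n) x) ≡⟨ rest≗ (s (suc n) x) ⟩
    cox β′ n (s (suc n) x)           ≡⟨ cox-lower {β′} {n} βN ⟨
    cox β′ (suc n) x                 ∎
    where
    open ≡-Reasoning
    far : ∀ {z} → z ∈ l₂ → suc z < suc n
    far z∈l₂ = below-top (∈-++⁺ʳ l₁ z∈l₂)
      (λ z≡n → unique-++-disjoint l₁ (↭-oneTo-unique rest↭) n∈l₁ (subst (_∈ l₂) z≡n z∈l₂))
  ... | no n∉l₁ | βN = begin
    coxeter (l₁ ++ suc n ∷ l₂) x     ≡⟨ coxeter-insert-left l₁ far x ⟩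
    s (suc n) (coxeter (l₁ ++ l₂) x) ≡⟨ cong (s (suc n)) (rest≗ x) ⟩
    s (suc n) (cox β′ n x)           ≡⟨ cox-upper {β′} {n} βN ⟨
    cox β′ (suc n) x                 ∎
    where
    open ≡-Reasoning
    far : ∀ {z} → z ∈ l₁ → suc z < suc n
    far z∈l₁ = below-top (∈-++⁺ˡ z∈l₁) (λ z≡n → n∉l₁ (subst (_∈ l₁) z≡n z∈l₁))

  lower⇒before′ : ∀ i → β′ i ≡ true → Before (l₁ ++ suc n ∷ l₂) (i ∸ 1) i
  lower⇒before′ i with i ≟ suc n
  ... | no _ = Before-insert l₁ ∘ lower⇒before₀ i
  ... | yes refl with n ∈? l₁
  ...   | yes n∈l₁ = λ _ → Before-++ l₁ n∈l₁ (here refl)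
  ...   | no _     = λ ()

Lower : (ℕ → Bool) → ℕ → ℕ → Set
Lower β n y = 2 ≤ y × y ≤ n × β y ≡ true

Upper : (ℕ → Bool) → ℕ → ℕ → Set
Upper β n y = 2 ≤ y × y ≤ n × β y ≡ false

Lower-weaken : ∀ {y} → Lower β n y → Lower β (suc n) y
Lower-weaken (2≤y , y≤n , eq) = 2≤y , m≤n⇒m≤1+n y≤n , eq

Upper-weaken : ∀ {y} → Upper β n y → Upper β (suc n) y
Upper-weaken (2≤y , y≤n , eq) = 2≤y , m≤n⇒m≤1+n y≤n , eq

AllBetween : (ℕ → Set) → ℕ → ℕ → Set
AllBetween P x v = ∀ y → x < y → y < v → P y

AllBetween-empty : ∀ {P} → AllBetween P x (suc x)
AllBetween-empty y x<y y<1+x = contradiction x<y (≤⇒≯ (≤-pred y<1+x))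

AllBetween-snoc : ∀ {P} → AllBetween P x v → P v → AllBetween P x (suc v)
AllBetween-snoc all Pv y x<y (s≤s y≤v) with m≤n⇒m<n∨m≡n y≤v
... | inj₁ y<v = all y x<y y<v
... | inj₂ refl = Pv

AllBetween-uncons : ∀ {P} m → AllBetween P x (suc x + suc m) → P (suc x) × AllBetween P (suc x) (suc (suc x) + m)
AllBetween-uncons {x} m all rewrite +-suc x m =
  all (suc x) ≤-refl (s≤s (s≤s (m≤m+n x m))) , λ y 1+x<y → all y (<-trans (n<1+n x) 1+x<y)

AllBetween-map : ∀ {P Q : ℕ → Set} → (∀ {y} → P y → Q y) → AllBetween P x v → AllBetween Q x v
AllBetween-map f all y x<y y<v = f (all y x<y y<v)

AllBetween-shrink : ∀ {P v′} → v ≤ v′ → AllBetween P x v′ → AllBetween P x v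
AllBetween-shrink v≤v′ all y x<y y<v = all y x<y (<-≤-trans y<v v≤v′)

Ascends : (ℕ → Bool) → ℕ → ℕ → ℕ → Set
Ascends β n x v = x < v × (v ≡ suc n ⊎ Lower β n v) × AllBetween (Upper β n) x v

Descends : (ℕ → Bool) → ℕ → ℕ → ℕ → Set
Descends β n x v = v < x × (v ≡ 1 ⊎ Upper β n v) × AllBetween (Lower β n) v x

Descends-weaken : Descends β n x v → Descends β (suc n) x v
Descends-weaken {β} (v<x , target , gap) =
  v<x , map₂ (Upper-weaken {β}) target , AllBetween-map (Lower-weaken {β}) gap

record CycleShape (β : ℕ → Bool) (n : ℕ) : Set where
  field
    fixes-above : ∀ x → suc n < x → cox β n x ≡ x
    ascends     : ∀ x → x ≡ 1 ⊎ Lower β n x → Ascends β n x (cox β n x)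
    descends    : ∀ x → x ≡ suc n ⊎ Upper β n x → Descends β n x (cox β n x)

cox-1 : ∀ β → cox β 1 ≗ s 1
cox-1 β x with β 1
... | true  = refl
... | false = refl

cycleShape-1 : ∀ β → CycleShape β 1
cycleShape-1 β = record
  { fixes-above = λ x 2<x → trans (cox-1 β x) (s-above 2<x)
  ; ascends     = λ { x (inj₁ refl) → subst (Ascends β 1 1) (sym (cox-1 β 1))
                                        (≤-refl , inj₁ refl , AllBetween-empty)
                    ; x (inj₂ (2≤x , x≤1 , _)) → contradiction 2≤x (≤⇒≯ x≤1) }
  ; descends    = λ { x (inj₁ refl) → subst (Descends β 1 2) (sym (cox-1 β 2))
                                        (≤-refl , inj₁ refl , AllBetween-empty)
                    ; x (inj₂ (2≤x , x≤1 , _)) → contradiction 2≤x (≤⇒≯ x≤1) }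
  }

module _ {β : ℕ → Bool} {n : ℕ} (1≤n : 1 ≤ n) (shape : CycleShape β n) where
  open CycleShape shape

  private
    top-lower : β (suc n) ≡ true → Lower β (suc n) (suc n)
    top-lower eq = s≤s 1≤n , ≤-refl , eq

    top-upper : β (suc n) ≡ false → Upper β (suc n) (suc n)
    top-upper eq = s≤s 1≤n , ≤-refl , eq

    ascent-start : x ≡ 1 ⊎ Lower β (suc n) x →
                   x ≤ n × (x ≡ 1 ⊎ Lower β n x) ⊎ x ≡ suc n × β (suc n) ≡ true
    ascent-start (inj₁ refl) = inj₁ (1≤n , inj₁ refl)
    ascent-start (inj₂ (2≤x , x≤1+n , βx)) with m≤n⇒m<n∨m≡n x≤1+n
    ... | inj₁ (s≤s x≤n) = inj₁ (x≤n , inj₂ (2≤x , x≤n , βx))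
    ... | inj₂ refl      = inj₂ (refl , βx)

    ascends-lift-lower : β (suc n) ≡ true → Ascends β n x v → Ascends β (suc n) x v
    ascends-lift-lower eq (x<v , target , gap) =
      x<v , inj₂ (lift target) , AllBetween-map (Upper-weaken {β}) gap
      where
      lift : v ≡ suc n ⊎ Lower β n v → Lower β (suc n) v
      lift (inj₁ refl) = top-lower eq
      lift (inj₂ lo)   = Lower-weaken {β} lo

    ascends-lift-upper : β (suc n) ≡ false → Ascends β n x v → Ascends β (suc n) x (s (suc n) v)
    ascends-lift-upper eq (x<v , inj₁ refl , gap) rewrite s-at (suc n) =
      m<n⇒m<1+n x<v , inj₁ refl , AllBetween-snoc (AllBetween-map (Upper-weaken {β}) gap) (top-upper eq)
    ascends-lift-upper eq (x<v , inj₂ lo@(_ , v≤n , _) , gap) rewrite s-below {suc n} (s≤s v≤n) =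
      x<v , inj₂ (Lower-weaken {β} lo) , AllBetween-map (Upper-weaken {β}) gap

    descent-start : Upper β (suc n) x → x ≡ suc n ⊎ Upper β n x
    descent-start (2≤x , x≤1+n , βx) with m≤n⇒m<n∨m≡n x≤1+n
    ... | inj₁ (s≤s x≤n) = inj₂ (2≤x , x≤n , βx)
    ... | inj₂ refl      = inj₁ refl

    descends-lift-upper : Descends β n x v → x ≤ suc n → Descends β (suc n) x (s (suc n) v)
    descends-lift-upper d@(v<x , _ , _) x≤1+n rewrite s-below {suc n} (<-≤-trans v<x x≤1+n) =
      Descends-weaken {β} d

    descends-lift-lower : β (suc n) ≡ true → Descends β n (suc n) v → Descends β (suc n) (suc (suc n)) v
    descends-lift-lower eq (v<1+n , target , gap) =
      m<n⇒m<1+n v<1+n , map₂ (Upper-weaken {β}) target ,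
      AllBetween-snoc (AllBetween-map (Lower-weaken {β}) gap) (top-lower eq)

  cycleShape-suc : CycleShape β (suc n)
  cycleShape-suc = record { fixes-above = fixes-above′ ; ascends = ascends′ ; descends = descends′ }
    where
    fixes-above′ : ∀ x → suc (suc n) < x → cox β (suc n) x ≡ x
    fixes-above′ x 2+n<x with β (suc n)
    ... | true  = trans (cong (cox β n) (s-above 2+n<x)) (fixes-above x (<-trans (n<1+n _) 2+n<x))
    ... | false = trans (cong (s (suc n)) (fixes-above x (<-trans (n<1+n _) 2+n<x))) (s-above 2+n<x)

    ascends′ : ∀ x → x ≡ 1 ⊎ Lower β (suc n) x → Ascends β (suc n) x (cox β (suc n) x)
    ascends′ x start with β (suc n) in eq | ascent-start start
    ... | true  | inj₁ (x≤n , start′) rewrite s-below {suc n} (s≤s x≤n) =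
      ascends-lift-lower eq (ascends x start′)
    ... | true  | inj₂ (refl , _) rewrite s-at (suc n) | fixes-above (suc (suc n)) ≤-refl =
      ≤-refl , inj₁ refl , AllBetween-empty
    ... | false | inj₁ (_ , start′) = ascends-lift-upper eq (ascends x start′)
    ... | false | inj₂ (_ , ())

    descends′ : ∀ x → x ≡ suc (suc n) ⊎ Upper β (suc n) x → Descends β (suc n) x (cox β (suc n) x)
    descends′ x start with β (suc n) in eq | start
    ... | true  | inj₁ refl rewrite s-at-suc (suc n) = descends-lift-lower eq (descends (suc n) (inj₁ refl))
    ... | true  | inj₂ up@(_ , _ , βx) with descent-start up
    ...   | inj₁ refl = contradiction (trans (sym eq) βx) λ ()
    ...   | inj₂ up′@(_ , x≤n , _) rewrite s-below {suc n} (s≤s x≤n) = Descends-weaken {β} (descends x (inj₂ up′))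
    descends′ x start | false | inj₁ refl rewrite fixes-above (suc (suc n)) ≤-refl | s-at-suc (suc n) =
      ≤-refl , inj₂ (top-upper eq) , AllBetween-empty
    descends′ x start | false | inj₂ up@(_ , x≤1+n , _) =
      descends-lift-upper (descends x (descent-start up)) x≤1+n

cycleShape : ∀ β n → 1 ≤ n → CycleShape β n
cycleShape β (suc zero)    _ = cycleShape-1 β
cycleShape β (suc (suc n)) _ = cycleShape-suc (s≤s z≤n) (cycleShape β (suc n) (s≤s z≤n))

countFalse : (ℕ → Bool) → ℕ → ℕ → ℕ
countFalse β a zero    = 0
countFalse β a (suc m) = (if β a then 0 else 1) + countFalse β (suc a) m

countFalse-true : ∀ β {a} m → β a ≡ true → countFalse β a (suc m) ≡ countFalse β (suc a) m
countFalse-true β m βa rewrite βa = refl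

countFalse-false : ∀ β {a} m → β a ≡ false → countFalse β a (suc m) ≡ suc (countFalse β (suc a) m)
countFalse-false β m βa rewrite βa = refl

countFalse-+ : ∀ β a m p → countFalse β a (m + p) ≡ countFalse β a m + countFalse β (a + m) p
countFalse-+ β a zero    p rewrite +-identityʳ a = refl
countFalse-+ β a (suc m) p rewrite countFalse-+ β (suc a) m p | +-suc a m =
  sym (+-assoc (if β a then 0 else 1) (countFalse β (suc a) m) _)

countFalse-≤ : ∀ β a m → countFalse β a m ≤ m
countFalse-≤ β a zero = z≤n
countFalse-≤ β a (suc m) with β a
... | true  = m≤n⇒m≤1+n (countFalse-≤ β (suc a) m)
... | false = s≤s (countFalse-≤ β (suc a) m)

countFalse-allTrue : ∀ β x m → AllBetween (λ y → β y ≡ true) x (suc x + m) → countFalse β (suc x) m ≡ 0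
countFalse-allTrue β x zero    all = refl
countFalse-allTrue β x (suc m) all with AllBetween-uncons m all
... | βx , all′ = trans (countFalse-true β m βx) (countFalse-allTrue β (suc x) m all′)

countFalse-allFalse : ∀ β x m → AllBetween (λ y → β y ≡ false) x (suc x + m) → countFalse β (suc x) m ≡ m
countFalse-allFalse β x zero    all = refl
countFalse-allFalse β x (suc m) all with AllBetween-uncons m all
... | βx , all′ = trans (countFalse-false β m βx) (cong suc (countFalse-allFalse β (suc x) m all′))

module Orbit {β : ℕ → Bool} {n : ℕ} (shape : CycleShape β n) {u : ℕ} (u-upper : Upper β n u) where
  open CycleShape shape

  private
    u≤n : u ≤ n
    u≤n = proj₁ (proj₂ u-upper)

    lower-true : ∀ {y} → Lower β n y → β y ≡ true
    lower-true (_ , _ , βy) = βy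

    upper-false : ∀ {y} → Upper β n y → β y ≡ false
    upper-false (_ , _ , βy) = βy

  -- Counting visited points: on its way from u to x = c^k(u) the orbit has visited exactly
  -- the upper-barred numbers in [x, u] while descending, and in addition 1 and the
  -- lower-barred numbers up to x once ascending. On intervals inside [2, n],
  -- countFalse β counts upper-barred numbers.
  Descending : ℕ → ℕ → Set
  Descending k x = Upper β n x × ∃ λ d → x + d ≡ u × countFalse β x d ≡ k

  Ascending : ℕ → ℕ → Set
  Ascending k x = (x ≡ 1 ⊎ Lower β n x) × ∃ λ e → x + suc e ≡ u × x + countFalse β (suc x) e ≡ k

  descend-step : ∀ {k x x′} → Descending k x → Descends β n x x′ →
                 Descending (suc k) x′ ⊎ Ascending (suc k) x′
  descend-step {k} {x} {x′} (_ , d , x+d≡u , count≡k) (x′<x , target , gap)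
    with g , 1+x′+g≡x ← m≤n⇒∃[o]m+o≡n x′<x = step target
    where
    reach : x′ + suc (g + d) ≡ u
    reach = begin
      x′ + suc (g + d) ≡⟨ +-suc x′ (g + d) ⟩
      suc x′ + (g + d) ≡⟨ sym (+-assoc (suc x′) g d) ⟩
      suc x′ + g + d   ≡⟨ cong (_+ d) 1+x′+g≡x ⟩
      x + d            ≡⟨ x+d≡u ⟩
      u                ∎
      where open ≡-Reasoning

    count : countFalse β (suc x′) (g + d) ≡ k
    count = begin
      countFalse β (suc x′) (g + d)                          ≡⟨ countFalse-+ β (suc x′) g d ⟩
      countFalse β (suc x′) g + countFalse β (suc x′ + g) d  ≡⟨ cong₂ _+_ gap-free (cong (λ y → countFalse β y d) 1+x′+g≡x) ⟩
      countFalse β x d                                       ≡⟨ count≡k ⟩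
      k                                                      ∎
      where
      open ≡-Reasoning
      gap-free : countFalse β (suc x′) g ≡ 0
      gap-free = countFalse-allTrue β x′ g
        (subst (AllBetween _ x′) (sym 1+x′+g≡x) (AllBetween-map lower-true gap))

    step : x′ ≡ 1 ⊎ Upper β n x′ → Descending (suc k) x′ ⊎ Ascending (suc k) x′
    step (inj₁ refl) = inj₂ (inj₁ refl , g + d , reach , cong suc count)
    step (inj₂ x′-upper) = inj₁ (x′-upper , suc (g + d) , reach ,
      trans (countFalse-false β (g + d) (upper-false x′-upper)) (cong suc count))

  ascend-step : ∀ {k x x′} → suc k < u → Ascending k x → Ascends β n x x′ → Ascending (suc k) x′
  ascend-step {k} {x} {x′} 1+k<u (_ , e , x+1+e≡u , x+count≡k) (x<x′ , target , gap)
    with g , 1+x+g≡x′ ← m≤n⇒∃[o]m+o≡n x<x′ =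
    [ (λ e≤g → contradiction (overshoot e≤g) (<⇒≱ 1+k<u)) , climb ]′ (≤-<-connex e g)
    where
    open ≡-Reasoning

    gap′ : AllBetween (λ y → β y ≡ false) x (suc x + g)
    gap′ = subst (AllBetween _ x) (sym 1+x+g≡x′) (AllBetween-map upper-false gap)

    -- were e ≤ g, the whole interval (x, u) would be upper-barred, forcing u = k + 1
    overshoot : e ≤ g → u ≤ suc k
    overshoot e≤g = ≤-reflexive (begin
      u                                ≡⟨ x+1+e≡u ⟨
      x + suc e                        ≡⟨ +-suc x e ⟩
      suc (x + e)                      ≡⟨ cong (λ m → suc (x + m)) all-upper ⟨
      suc (x + countFalse β (suc x) e) ≡⟨ cong suc x+count≡k ⟩
      suc k                            ∎)
      where
      all-upper : countFalse β (suc x) e ≡ e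
      all-upper = countFalse-allFalse β x e (AllBetween-shrink (+-monoʳ-≤ (suc x) e≤g) gap′)

    climb : g < e → Ascending (suc k) x′
    climb g<e with e′ , 1+g+e′≡e ← m≤n⇒∃[o]m+o≡n g<e = inj₂ x′-lower , e′ , reach , count
      where
      reach : x′ + suc e′ ≡ u
      reach = begin
        x′ + suc e′           ≡⟨ cong (_+ suc e′) 1+x+g≡x′ ⟨
        suc x + g + suc e′    ≡⟨ rearrange x g e′ ⟩
        x + suc (suc g + e′)  ≡⟨ cong (λ m → x + suc m) 1+g+e′≡e ⟩
        x + suc e             ≡⟨ x+1+e≡u ⟩
        u                     ∎
        where
        open +-*-Solver using (solve; _:+_; _:=_; con)
        rearrange : ∀ x g e′ → suc x + g + suc e′ ≡ x + suc (suc g + e′)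
        rearrange = solve 3 (λ x g e′ → con 1 :+ x :+ g :+ (con 1 :+ e′) := x :+ (con 1 :+ (con 1 :+ g :+ e′))) refl

      x′-lower : Lower β n x′
      x′-lower = [ (λ x′≡1+n → contradiction x′≡1+n x′≢1+n) , id ]′ target
        where
        x′≢1+n : x′ ≢ suc n
        x′≢1+n = <⇒≢ (<-≤-trans (subst (x′ <_) reach (m<m+n x′ z<s)) (m≤n⇒m≤1+n u≤n))

      split : countFalse β (suc x) e ≡ g + countFalse β (suc x′) e′
      split = begin
        countFalse β (suc x) e                                     ≡⟨ cong (countFalse β (suc x)) (trans (+-suc g e′) 1+g+e′≡e) ⟨
        countFalse β (suc x) (g + suc e′)                          ≡⟨ countFalse-+ β (suc x) g (suc e′) ⟩
        countFalse β (suc x) g + countFalse β (suc x + g) (suc e′) ≡⟨ cong₂ _+_ (countFalse-allFalse β x g gap′)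
                                                                      (cong (λ y → countFalse β y (suc e′)) 1+x+g≡x′) ⟩
        g + countFalse β x′ (suc e′)                               ≡⟨ cong (g +_) (countFalse-true β e′ (lower-true x′-lower)) ⟩
        g + countFalse β (suc x′) e′                               ∎

      count : x′ + countFalse β (suc x′) e′ ≡ suc k
      count = begin
        x′ + countFalse β (suc x′) e′            ≡⟨ cong (_+ countFalse β (suc x′) e′) 1+x+g≡x′ ⟨
        suc x + g + countFalse β (suc x′) e′     ≡⟨ cong suc (+-assoc x g _) ⟩
        suc (x + (g + countFalse β (suc x′) e′)) ≡⟨ cong (λ m → suc (x + m)) split ⟨
        suc (x + countFalse β (suc x) e)         ≡⟨ cong suc x+count≡k ⟩
        suc k                                    ∎

  orbit-invariant : ∀ k → k < u → Descending k (iter k (cox β n) u) ⊎ Ascending k (iter k (cox β n) u)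
  orbit-invariant zero    _     = inj₁ (u-upper , 0 , +-identityʳ u , refl)
  orbit-invariant (suc k) 1+k<u with orbit-invariant k (<-trans (n<1+n k) 1+k<u)
  ... | inj₁ desc@(x-upper , _) = descend-step desc (descends _ (inj₂ x-upper))
  ... | inj₂ asc@(start , _)    = inj₂ (ascend-step 1+k<u asc (ascends _ start))

  orbit-bound : ∀ k → k < u → k + u ≤ suc n → iter k (cox β n) u + k ≤ n
  orbit-bound k k<u k+u≤1+n with iter k (cox β n) u | orbit-invariant k k<u
  ... | x | inj₁ (_ , d , x+d≡u , count≡k) = begin
    x + k                ≡⟨ cong (x +_) count≡k ⟨
    x + countFalse β x d ≤⟨ +-monoʳ-≤ x (countFalse-≤ β x d) ⟩
    x + d                ≡⟨ x+d≡u ⟩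
    u                    ≤⟨ u≤n ⟩
    n                    ∎
    where open ≤-Reasoning
  ... | x | inj₂ (_ , e , _ , x+count≡k) = begin
    x + k  ≤⟨ +-monoˡ-≤ k (subst (x ≤_) x+count≡k (m≤m+n x _)) ⟩
    k + k  ≤⟨ ≤-pred (≤-trans (+-monoʳ-< k k<u) k+u≤1+n) ⟩
    n      ∎
    where open ≤-Reasoning

iter-cong : ∀ k {f g : ℕ → ℕ} → f ≗ g → iter k f ≗ iter k g
iter-cong zero    f≗g x = refl
iter-cong (suc k) {g = g} f≗g x = trans (f≗g _) (cong g (iter-cong k f≗g x))

μ-bounds : ∀ {n u k} → 1 ≤ u → u ≤ suc n → k ≤ μ n u → k < u × k + u ≤ suc n
μ-bounds {n} {suc u} {k} _ u≤1+n k≤μ =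
  s≤s (m≤n⊓o⇒m≤n u _ k≤μ) , m≤o∸n⇒m+n≤o k u≤1+n (m≤n⊓o⇒m≤o u _ k≤μ)

+≤⇒<∸ : ∀ {n x k} → x + k ≤ n → x < n + 2 ∸ k
+≤⇒<∸ {n} {x} x+k≤n = m+n≤o⇒m≤o∸n (suc x) (≤-trans (s≤s (m≤n⇒m≤1+n x+k≤n)) (≤-reflexive (+-comm 2 n)))

proposition5p5 : (n : ℕ) (a : List ℕ) → IsCoxeterWord n a →
    (u : ℕ) → UpperBarred n a u →
    (k : ℕ) → 1 ≤ k → k ≤ μ n u →
    iter k (coxeter a) u < (n + 2) ∸ k
proposition5p5 n a a↭ u (2≤u , u≤n , ¬precedes) k _ k≤μ
  with k<u , k+u≤1+n ← μ-bounds (<⇒≤ 2≤u) (m≤n⇒m≤1+n u≤n) k≤μ =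
  subst (_< n + 2 ∸ k) (sym (iter-cong k coxeter≗cox u))
    (+≤⇒<∸ (Orbit.orbit-bound shape u-upper k k<u k+u≤1+n))
  where
  open Barring (wordBarring n a a↭)

  shape : CycleShape lowerBarred n
  shape = cycleShape lowerBarred n (≤-trans (<⇒≤ 2≤u) u≤n)

  u-upper : Upper lowerBarred n u
  u-upper with lowerBarred u in eq
  ... | true  = contradiction (Before⇒Precedes (lower⇒before u eq)) ¬precedes
  ... | false = 2≤u , u≤n , refl
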